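{- Let $\mathcal{C}=(V,\mathcal{R})$ be a coherent configuration with fibers $X,Y$ such that $m=|X|=|Y|$ is a prime, $r=|\mathcal{R}_X|>2$ and $|\mathcal{R}_{X,Y}|>1$. If $S,T\in\mathcal{R}_{X,Y}$ satisfy $ST^t=\{R\}$, then $c_{RR^t}^{R_1}\ge d_T$ for each $R_1\in SS^t$, and $c_{R^tR}^{R_2}\ge d_S$ for each $R_2\in TT^t$.
   Context: A coherent configuration is a pair $\mathcal{C}=(V,\mathcal{R})$ where $V$ is a finite set and $\mathcal{R}$ is a partition of $V\times V$ into nonempty sets such that: (1) the diagonal $\Delta_V$ is a union of elements of $\mathcal{R}$; (2) $R^t=\{(u,v)\mid (v,u)\in R\}\in\mathcal{R}$ for each $R\in\mathcal{R}$; (3) for all $R,S,T\in\mathcal{R}$ there is a constant $c_{RS}^T$ with $c_{RS}^T=|R(u)\cap S^t(v)|$ for all $(u,v)\in T$, where $R(w)=\{z\mid (w,z)\in R\}$. A fiber is a subset $X\subseteq V$ with $\Delta_X=\{(x,x)\mid x\in X\}\in\mathcal{R}$ ($\mathcal{C}$ may have other fibers besides $X,Y$). For fibers $X,Y$, $\mathcal{R}_{X,Y}=\{R\in\mathcal{R}\mid R\subseteq X\times Y\}$ and $\mathcal{R}_X=\mathcal{R}_{X,X}$. For $R\in\mathcal{R}_{X,Y}$, $d_R=c_{RR^t}^{\Delta_X}$, which equals $|R(x)|$ for every $x\in X$. Complex product: for $S,T\in\mathcal{R}$, $ST=\{R\in\mathcal{R}\mid c_{ST}^R>0\}$. -}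

module Defs where

open import Data.Nat using (ℕ; _<_; _≤_)
import Agda.Primitive
open import Data.Fin using (Fin; _≟_)
open import Data.List using (length; filter)
open import Data.List.Base using ()
open import Data.Fin.Base using ()
open import Data.List using (List)
open import Data.Product using (Σ; ∃; ∃₂; _×_; _,_)
open import Relation.Nullary using (¬_)
open import Relation.Nullary.Decidable using (_×-dec_)
open import Relation.Unary using (Pred; Decidable)
open import Relation.Binary.PropositionalEquality using (_≡_)
open import Function.Bundles using (_⇔_)
import Data.List.Base as L

allFin' : (n : ℕ) → List (Fin n)
allFin' n = L.tabulate (λ i → i)

count : {n : ℕ} {P : Pred (Fin n) Agda.Primitive.lzero} → Decidable P → ℕ
count {n} P? = length (filter P? (allFin' n))

-- A coherent configuration on V = Fin n whose set of basis relations
-- ℛ is indexed by Fin k: the basis relation with index i is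
-- { (u , v) | col u v ≡ i }.  Thus ℛ is a partition of V × V.
record CoherentConfiguration : Set₁ where
  field
    n k : ℕ
    col : Fin n → Fin n → Fin k
    nonempty : ∀ (i : Fin k) → ∃₂ λ u v → col u v ≡ i
    -- (1) the diagonal is a union of basis relations
    diagonal : ∀ (u v w : Fin n) → col v w ≡ col u u → v ≡ w
    tr : Fin k → Fin k
    tr-spec : ∀ (i : Fin k) (u v : Fin n) → (col u v ≡ i) ⇔ (col v u ≡ tr i)
    -- (3) intersection numbers c r s t = |R(u) ∩ S^t(v)| for (u , v) ∈ T
    c : Fin k → Fin k → Fin k → ℕ
    c-spec : ∀ (r s t : Fin k) (u v : Fin n) → col u v ≡ t →
             count (λ w → (col u w ≟ r) ×-dec (col w v ≟ s)) ≡ c r s t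

module _ (C : CoherentConfiguration) where
  open CoherentConfiguration C

  -- a fiber X is given by the index x of the basis relation Δ_X
  -- (a basis relation contained in the diagonal); X = { u | col u u ≡ x }
  IsFiber : Fin k → Set
  IsFiber x = ∀ (u v : Fin n) → col u v ≡ x → u ≡ v

  fiberSize : Fin k → ℕ
  fiberSize x = count (λ u → col u u ≟ x)

  InRel : Fin k → Fin k → Fin k → Set
  InRel x y i = ∀ (u v : Fin n) → col u v ≡ i → (col u u ≡ x) × (col v v ≡ y)

  ProductIs : Fin k → Fin k → Fin k → Set
  ProductIs s t r = ∀ (q : Fin k) → (0 < c s t q) ⇔ (q ≡ r)

  valency : Fin k → Fin k → ℕ
  valency x i = c i (tr i) x

-- Take (u , u′) ∈ R₁ and w ∈ S(u) ∩ S(u′). Since S T^t = {R}, every z ∈ T^t(w) lies in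
-- R(u) ∩ R^t(u′), so c_{R R^t}^{R₁} ≥ |T^t(w)| = d_{T^t}. Double counting the pairs of T gives
-- |X| d_T = |Y| d_{T^t}, hence d_{T^t} = d_T because |X| = |Y| ≠ 0. The second claim is the
-- first one for the triple T, S, R^t, since (S T^t)^t = T S^t.
module Submission where

open import Defs
open import Data.Nat using (ℕ; zero; suc; _*_; _<_; _≤_; NonZero)
open import Data.Nat.Properties using (+-*-semiring; *-identityˡ; *-cancelˡ-≡; module ≤-Reasoning)
open import Data.Nat.Primality using (Prime; prime⇒nonZero)
open import Data.Fin using (Fin; zero; suc; _≟_)
open import Data.List using (_∷_; length; filter; tabulate)
open import Data.List.Properties using (filter-≐; filter-none)
open import Data.List.Membership.Propositional.Properties using (∈-tabulate⁺; ∈-filter⁺; ∈-filter⁻; ∈-length)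
open import Data.List.Relation.Unary.Any using (here)
open import Data.List.Membership.Propositional using (_∈_)
import Data.List.Relation.Unary.All as All
import Data.List.Relation.Binary.Sublist.Propositional as Sublist
import Data.List.Relation.Binary.Sublist.Propositional.Properties as Sublist
open import Data.Product using (∃; _×_; _,_; proj₁; proj₂)
open import Function.Bundles using (Equivalence; mk⇔)
open import Level using (0ℓ)
open import Relation.Nullary using (¬_; Dec; yes; no)
open import Relation.Nullary.Decidable using (_×-dec_)
open import Relation.Unary using (Pred; Decidable; _⊆_; _≐_)
open import Relation.Binary.PropositionalEquality using (_≡_; refl; sym; trans; cong; subst; module ≡-Reasoning)
open import Algebra.Properties.Semiring.Sum +-*-semiring using (sum; sum-syntax; sum-cong-≗; ∑-comm; *-distribʳ-sum)

indicator : {A : Set} → Dec A → ℕ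
indicator (yes _) = 1
indicator (no _)  = 0

length-filter-tabulate : ∀ {m} {A : Set} {P : Pred A 0ℓ} (P? : Decidable P) (f : Fin m → A) →
  length (filter P? (tabulate f)) ≡ ∑[ i < m ] indicator (P? (f i))
length-filter-tabulate {zero}  P? f = refl
length-filter-tabulate {suc m} P? f with P? (f zero)
... | yes _ = cong suc (length-filter-tabulate P? (λ i → f (suc i)))
... | no _  = length-filter-tabulate P? (λ i → f (suc i))

module _ {n : ℕ} {P Q : Pred (Fin n) 0ℓ} (P? : Decidable P) (Q? : Decidable Q) where

  count-mono : P ⊆ Q → count P? ≤ count Q?
  count-mono P⊆Q = Sublist.length-mono-≤ (Sublist.filter⁺ P? Q? (λ { refl → P⊆Q }) (Sublist.⊆-refl {x = allFin' n}))

  count-≐ : P ≐ Q → count P? ≡ count Q?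
  count-≐ P≐Q = cong length (filter-≐ P? Q? P≐Q (allFin' n))

module _ {n : ℕ} {P : Pred (Fin n) 0ℓ} (P? : Decidable P) where

  count-empty : (∀ i → ¬ P i) → count P? ≡ 0
  count-empty ¬P = cong length (filter-none P? (All.universal ¬P (allFin' n)))

  count-pos⁺ : ∀ i → P i → 0 < count P?
  count-pos⁺ i p = ∈-length (∈-filter⁺ P? (∈-tabulate⁺ i) p)

  count-pos⁻ : 0 < count P? → ∃ P
  count-pos⁻ pos with filter P? (allFin' n) in eq
  ... | i ∷ _ = i , proj₂ (∈-filter⁻ P? {xs = allFin' n} (subst (i ∈_) (sym eq) (here refl)))

  count≡∑indicator : count P? ≡ ∑[ i < n ] indicator (P? i)
  count≡∑indicator = length-filter-tabulate P? (λ i → i)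

  ∑≡count* : (d : ℕ) (f : Fin n → ℕ) → (∀ i → f i ≡ indicator (P? i) * d) → sum f ≡ count P? * d
  ∑≡count* d f f≡ = begin
    sum f                               ≡⟨ sum-cong-≗ f≡ ⟩
    ∑[ i < n ] (indicator (P? i) * d)   ≡⟨ sym (*-distribʳ-sum d (λ i → indicator (P? i))) ⟩
    (∑[ i < n ] indicator (P? i)) * d   ≡⟨ cong (_* d) (sym count≡∑indicator) ⟩
    count P? * d                        ∎
    where open ≡-Reasoning

∑-count-transpose : ∀ {m n} {E : Fin m → Fin n → Set} (E? : ∀ u → Decidable (E u)) →
  ∑[ u < m ] count (E? u) ≡ ∑[ v < n ] count (λ u → E? u v)
∑-count-transpose {m} {n} E? = begin
  ∑[ u < m ] count (E? u)                         ≡⟨ sum-cong-≗ (λ u → count≡∑indicator (E? u)) ⟩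
  ∑[ u < m ] ∑[ v < n ] indicator (E? u v)        ≡⟨ ∑-comm (λ u v → indicator (E? u v)) ⟩
  ∑[ v < n ] ∑[ u < m ] indicator (E? u v)        ≡⟨ sum-cong-≗ (λ v → sym (count≡∑indicator (λ u → E? u v))) ⟩
  ∑[ v < n ] count (λ u → E? u v)                 ∎
  where open ≡-Reasoning

module Configuration (C : CoherentConfiguration) where
  open CoherentConfiguration C

  col-tr : ∀ {i u v} → col u v ≡ i → col v u ≡ tr i
  col-tr {i} {u} {v} = Equivalence.to (tr-spec i u v)

  col-tr⁻ : ∀ {i u v} → col v u ≡ tr i → col u v ≡ i
  col-tr⁻ {i} {u} {v} = Equivalence.from (tr-spec i u v)

  tr-involutive : ∀ i → tr (tr i) ≡ i
  tr-involutive i with nonempty i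
  ... | u , v , uv = trans (sym (col-tr (col-tr uv))) uv

  InRel-tr : ∀ {x y i} → InRel C x y i → InRel C y x (tr i)
  InRel-tr i∈XY u v uv with i∈XY v u (col-tr⁻ uv)
  ... | vv , uu = uu , vv

  path⇒0<c : ∀ {r s t u v} w → col u v ≡ t → col u w ≡ r → col w v ≡ s → 0 < c r s t
  path⇒0<c {r} {s} {t} {u} {v} w uv uw wv =
    subst (0 <_) (c-spec r s t u v uv) (count-pos⁺ (λ w → (col u w ≟ r) ×-dec (col w v ≟ s)) w (uw , wv))

  0<c⇒path : ∀ {r s t u v} → col u v ≡ t → 0 < c r s t → ∃ λ w → col u w ≡ r × col w v ≡ s
  0<c⇒path {r} {s} {t} {u} {v} uv pos =
    count-pos⁻ (λ w → (col u w ≟ r) ×-dec (col w v ≟ s)) (subst (0 <_) (sym (c-spec r s t u v uv)) pos)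

  ProductIs-sole : ∀ {s t r u v} w → ProductIs C s t r → col u w ≡ s → col w v ≡ t → col u v ≡ r
  ProductIs-sole w prod uw wv = Equivalence.to (prod _) (path⇒0<c w refl uw wv)

  ProductIs-tr : ∀ {s t r} → ProductIs C s t r → ProductIs C (tr t) (tr s) (tr r)
  ProductIs-tr {s} {t} {r} prod q = mk⇔ (to q) (from q)
    where
    to : ∀ q → 0 < c (tr t) (tr s) q → q ≡ tr r
    to q pos with nonempty q
    ... | u , v , uv with 0<c⇒path uv pos
    ... | w , uw , wv = trans (sym uv) (col-tr (ProductIs-sole w prod (col-tr⁻ wv) (col-tr⁻ uw)))

    from : ∀ q → q ≡ tr r → 0 < c (tr t) (tr s) q
    from _ refl with nonempty r
    ... | u , v , uv with 0<c⇒path uv (Equivalence.from (prod r) refl)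
    ... | w , uw , wv = path⇒0<c w (col-tr uv) (col-tr wv) (col-tr uw)

  out-degree : ∀ {x i u} → col u u ≡ x → count (λ v → col u v ≟ i) ≡ valency C x i
  out-degree {x} {i} {u} uu =
    trans (count-≐ (λ v → col u v ≟ i) (λ v → (col u v ≟ i) ×-dec (col v u ≟ tr i))
                  ((λ ui → ui , col-tr ui) , proj₁)) (c-spec i (tr i) x u u uu)

  out-degree-indicator : ∀ {x y i} → InRel C x y i →
    ∀ u → count (λ v → col u v ≟ i) ≡ indicator (col u u ≟ x) * valency C x i
  out-degree-indicator {x} i∈XY u with col u u ≟ x
  ... | yes uu = trans (out-degree uu) (sym (*-identityˡ _))
  ... | no ¬uu = count-empty _ (λ v ui → ¬uu (proj₁ (i∈XY u v ui)))

  fiberSize*valency : ∀ {x y i} → InRel C x y i →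
    fiberSize C x * valency C x i ≡ fiberSize C y * valency C y (tr i)
  fiberSize*valency {x} {y} {i} i∈XY = begin
    fiberSize C x * valency C x i             ≡⟨ sym (∑≡count* (λ u → col u u ≟ x) _ _ (out-degree-indicator i∈XY)) ⟩
    ∑[ u < n ] count (λ v → col u v ≟ i)      ≡⟨ ∑-count-transpose (λ u v → col u v ≟ i) ⟩
    ∑[ v < n ] count (λ u → col u v ≟ i)      ≡⟨ sum-cong-≗ (λ v → count-≐ (λ u → col u v ≟ i) (λ u → col v u ≟ tr i) (col-tr , col-tr⁻)) ⟩
    ∑[ v < n ] count (λ u → col v u ≟ tr i)   ≡⟨ ∑≡count* (λ v → col v v ≟ y) _ _ (out-degree-indicator (InRel-tr i∈XY)) ⟩
    fiberSize C y * valency C y (tr i)        ∎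
    where open ≡-Reasoning

  in-degree : ∀ {x y i v} → fiberSize C x ≡ fiberSize C y → .{{NonZero (fiberSize C x)}} →
    InRel C x y i → col v v ≡ y → count (λ u → col u v ≟ i) ≡ valency C x i
  in-degree {x} {y} {i} {v} |X|≡|Y| i∈XY vv = begin
    count (λ u → col u v ≟ i)      ≡⟨ count-≐ (λ u → col u v ≟ i) (λ u → col v u ≟ tr i) (col-tr , col-tr⁻) ⟩
    count (λ u → col v u ≟ tr i)   ≡⟨ out-degree vv ⟩
    valency C y (tr i)             ≡⟨ *-cancelˡ-≡ _ _ (fiberSize C x) |X|*dTᵗ≡|X|*dT ⟩
    valency C x i                  ∎
    where
    open ≡-Reasoning
    |X|*dTᵗ≡|X|*dT : fiberSize C x * valency C y (tr i) ≡ fiberSize C x * valency C x i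
    |X|*dTᵗ≡|X|*dT = trans (cong (_* valency C y (tr i)) |X|≡|Y|) (sym (fiberSize*valency i∈XY))

  valency≤c-RRᵗ : ∀ {x y S T R} → fiberSize C x ≡ fiberSize C y → .{{NonZero (fiberSize C x)}} →
    InRel C x y S → InRel C x y T → ProductIs C S (tr T) R →
    ∀ R₁ → 0 < c S (tr S) R₁ → valency C x T ≤ c R (tr R) R₁
  valency≤c-RRᵗ {x} {S = S} {T} {R} |X|≡|Y| S∈XY T∈XY prod R₁ pos with nonempty R₁
  ... | u , u' , uu' with 0<c⇒path uu' pos
  ... | w , uw , wu' = begin
    valency C x T                                        ≡⟨ sym (in-degree |X|≡|Y| T∈XY (proj₂ (S∈XY u w uw))) ⟩
    count (λ z → col z w ≟ T)                            ≤⟨ count-mono (λ z → col z w ≟ T) (λ z → (col u z ≟ R) ×-dec (col z u' ≟ tr R)) Tᵗ[w]⊆R[u]∩Rᵗ[u'] ⟩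
    count (λ z → (col u z ≟ R) ×-dec (col z u' ≟ tr R))  ≡⟨ c-spec R (tr R) R₁ u u' uu' ⟩
    c R (tr R) R₁                                        ∎
    where
    open ≤-Reasoning
    Tᵗ[w]⊆R[u]∩Rᵗ[u'] : ∀ {z} → col z w ≡ T → col u z ≡ R × col z u' ≡ tr R
    Tᵗ[w]⊆R[u]∩Rᵗ[u'] zw = ProductIs-sole w prod uw (col-tr zw) , col-tr (ProductIs-sole w prod (col-tr⁻ wu') (col-tr zw))

  valency≤c-RᵗR : ∀ {x y S T R} → fiberSize C x ≡ fiberSize C y → .{{NonZero (fiberSize C x)}} →
    InRel C x y S → InRel C x y T → ProductIs C S (tr T) R →
    ∀ R₂ → 0 < c T (tr T) R₂ → valency C x S ≤ c (tr R) R R₂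
  valency≤c-RᵗR {x} {S = S} {T} {R} |X|≡|Y| S∈XY T∈XY prod R₂ =
    subst (λ R' → 0 < c T (tr T) R₂ → valency C x S ≤ c (tr R) R' R₂) (tr-involutive R)
      (valency≤c-RRᵗ |X|≡|Y| T∈XY S∈XY TSᵗ≡Rᵗ R₂)
    where
    TSᵗ≡Rᵗ : ProductIs C T (tr S) (tr R)
    TSᵗ≡Rᵗ = subst (λ T' → ProductIs C T' (tr S) (tr R)) (tr-involutive T) (ProductIs-tr prod)

lemma3p6 : (C : CoherentConfiguration) →
    let open CoherentConfiguration C in
    (x y : Fin k) → IsFiber C x → IsFiber C y →
    fiberSize C x ≡ fiberSize C y → Prime (fiberSize C x) →
    (∃ λ a → ∃ λ b → ∃ λ e → InRel C x x a × InRel C x x b × InRel C x x e ×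
       ¬ a ≡ b × ¬ a ≡ e × ¬ b ≡ e) →
    (∃ λ a → ∃ λ b → InRel C x y a × InRel C x y b × ¬ a ≡ b) →
    (S T R : Fin k) → InRel C x y S → InRel C x y T →
    ProductIs C S (tr T) R →
    (∀ (R₁ : Fin k) → 0 < c S (tr S) R₁ → valency C x T ≤ c R (tr R) R₁) ×
    (∀ (R₂ : Fin k) → 0 < c T (tr T) R₂ → valency C x S ≤ c (tr R) R R₂)
-- Primality of m is used only for m ≠ 0.
lemma3p6 C x y _ _ |X|≡|Y| |X|-prime _ _ S T R S∈XY T∈XY prod =
  valency≤c-RRᵗ |X|≡|Y| S∈XY T∈XY prod , valency≤c-RᵗR |X|≡|Y| S∈XY T∈XY prod
  where
  open Configuration C
  instance
    |X|≢0 : NonZero (fiberSize C x)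
    |X|≢0 = prime⇒nonZero |X|-prime
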